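{- Let $\mathcal{M}$ be a transversal matroid of rank $r$ and let $I_1 \prec I_2 \prec \cdots \prec I_m$ be the subsets $I \subseteq [r]$ that occur as types of elements of the ground set of $\mathcal{M}$. Then a sequence of nonnegative integers $a=(a_1,\dots,a_m)$ is a maximal valid type sequence of $\mathcal{M}$ if and only if it is a $\overline{G_{\mathcal{M}}}$-draconian sequence.
   Context: $\mathcal{M}$ is a rank $r$ transversal matroid on ground set $[n]=\{1,\dots,n\}$, given by a presentation $(A_1,\dots,A_r)$ with exactly $r$ members $A_j \subseteq [n]$: the bases are the sets of ground-set elements covered by maximal matchings in the bipartite graph with edges $(x,j)$ for $x \in A_j$. The type of an element $x \in [n]$ is $\phi(x)=\{j \in [r] : x \in A_j\}$. For $I \subseteq [r]$, $l_{\mathcal{M},I}$ denotes the number of elements of type $I$. Subsets of $[r]$ are totally ordered by $I \prec I'$ if $|I|<|I'|$, or $|I|=|I'|$ and $I$ is lexicographically smaller; $I_1 \prec \cdots \prec I_m$ are exactly the subsets $I$ with $l_{\mathcal{M},I}>0$. For a sequence $a=(a_1,\dots,a_m)$ of nonnegative integers, let $\mathcal{I}^a$ be the multiset consisting of $a_i$ copies of $I_i$ for each $i$. The sequence $a$ is valid if $\mathcal{I}^a$ satisfies Hall's condition (the union of any $t$ sets of the collection has cardinality at least $t$), and maximal if $\sum_i a_i = r$. $\overline{G_{\mathcal{M}}}$ is the bipartite graph with left vertices $1,\dots,m$ (vertex $i$ corresponding to the type $I_i$, i.e. all ground-set elements of the same type identified) and right vertices $0',1',\dots,r'$, with an edge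 $(i,j')$ if and only if $j \in I_i \cup \{0\}$ (so the extra right vertex $0'$ is joined to every left vertex). A sequence of nonnegative integers $(a_1,\dots,a_m)$ is $\overline{G_{\mathcal{M}}}$-draconian if $\sum_i a_i = r$ and for every subset $\{i_1<\cdots<i_k\}\subseteq [m]$ one has $|(I_{i_1}\cup\{0\})\cup\cdots\cup(I_{i_k}\cup\{0\})| \ge a_{i_1}+\cdots+a_{i_k}+1$; equivalently, the multiset $(I_1\cup\{0\})^{a_1},\dots,(I_m\cup\{0\})^{a_m}$ satisfies the dragon marriage condition. -}

module Defs where

open import Data.Nat using (ℕ; zero; suc; _+_; _≤_; _<_)
open import Data.Bool using (Bool; true; false; if_then_else_)
open import Data.Fin using (Fin)
import Data.Fin as Fin
open import Data.Fin.Subset using (Subset; ⋃; ∣_∣; ⊥; Nonempty; _∈_)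
open import Data.Fin.Subset.Properties using (_∈?_)
open import Data.Vec using (Vec; _∷_; tabulate; lookup)
open import Data.List using (List; map; filter; allFin)
open import Data.Nat.ListAction using (sum)
open import Data.List.Relation.Binary.Lex.Strict using (Lex-<)
open import Data.Product using (Σ; ∃; _×_)
open import Data.Sum using (_⊎_)
open import Relation.Binary.PropositionalEquality using (_≡_)
open import Relation.Nullary using (does)
open import Function.Bundles using (_⇔_)
import Data.Vec.Properties as VecP
import Data.Bool.Properties as BoolP

-- A presentation (A_1,…,A_r) of a rank-r transversal matroid on [n]:
-- exactly r members, A j ⊆ [n]  (Fin r indexes 1..r, Fin n indexes 1..n).
Presentation : ℕ → ℕ → Set
Presentation r n = Fin r → Subset n

type : ∀ {r n} → Presentation r n → Fin n → Subset r
type A x = tabulate (λ j → lookup (A j) x)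

_≟ˢ_ : ∀ {r} (I J : Subset r) → Relation.Nullary.Dec (I ≡ J)
_≟ˢ_ = VecP.≡-dec BoolP._≟_

l : ∀ {r n} → Presentation r n → Subset r → ℕ
l A I = ∣ tabulate (λ x → does (type A x ≟ˢ I)) ∣

elems : ∀ {r} → Subset r → List (Fin r)
elems I = filter (_∈? I) (allFin _)

_≺_ : ∀ {r} → Subset r → Subset r → Set
I ≺ J = (∣ I ∣ < ∣ J ∣) ⊎ ((∣ I ∣ ≡ ∣ J ∣) × Lex-< _≡_ Fin._<_ (elems I) (elems J))

IsTypeEnumeration : ∀ {r n m} → Presentation r n → (Fin m → Subset r) → Set
IsTypeEnumeration {r} {n} {m} A I =
  (∀ (i j : Fin m) → i Fin.< j → I i ≺ I j) ×
  (∀ (J : Subset r) → (0 < l A J) ⇔ (∃ λ i → I i ≡ J))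

Σᶠ : ∀ {m} → (Fin m → ℕ) → ℕ
Σᶠ {m} f = sum (map f (allFin m))

Σ∈ : ∀ {m} → Subset m → (Fin m → ℕ) → ℕ
Σ∈ S f = Σᶠ (λ i → if lookup S i then f i else 0)

⋃∈ : ∀ {m k} → Subset m → (Fin m → Subset k) → Subset k
⋃∈ {m} S F = ⋃ (map (λ i → if lookup S i then F i else ⊥) (allFin m))

-- indices i with b i > 0 (the sets occurring in the sub-multiset b)
support : ∀ {m} → (Fin m → ℕ) → Subset m
support b = tabulate (λ i → positive (b i))
  where
  positive : ℕ → Bool
  positive zero = false
  positive (suc _) = true

-- a is valid: the multiset 𝓘^a (a_i copies of I_i) satisfies Hall's condition,
-- i.e. every sub-multiset (b_i ≤ a_i copies of I_i), consisting of t = Σ b sets,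
-- has union of cardinality ≥ t.
Valid : ∀ {r m} → (Fin m → Subset r) → (Fin m → ℕ) → Set
Valid {r} {m} I a =
  ∀ (b : Fin m → ℕ) → (∀ i → b i ≤ a i) → Σᶠ b ≤ ∣ ⋃∈ (support b) I ∣

Maximal : ∀ {r m} → (Fin m → ℕ) → Set
Maximal {r} a = Σᶠ a ≡ r

-- neighbourhood of left vertex i in the graph \overline{G_M}:
-- right vertices 0',1',…,r' are Fin (suc r) (zero = 0', suc j = (j+1)'),
-- N(i) = I_i ∪ {0}.
Gbar-nbhd : ∀ {r m} → (Fin m → Subset r) → Fin m → Subset (suc r)
Gbar-nbhd I i = true ∷ I i

Draconian : ∀ {r m} → (Fin m → Subset r) → (Fin m → ℕ) → Set
Draconian {r} {m} I a =
  (Σᶠ a ≡ r) ×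
  (∀ (S : Subset m) → Nonempty S → Σ∈ S a + 1 ≤ ∣ ⋃∈ S (Gbar-nbhd I) ∣)

module Submission where

-- The extra right vertex 0' of the graph Ḡ_M is adjacent to every left vertex,
-- so for every nonempty set S of left vertices the neighbourhood of S in Ḡ_M is
-- {0'} ∪ ⋃_{i∈S} I_i, of cardinality exactly 1 + |⋃_{i∈S} I_i|.  Hence the
-- dragon marriage condition for a says precisely
--     (set Hall)   Σ_{i∈S} a_i ≤ |⋃_{i∈S} I_i|   for every nonempty S ⊆ [m].
-- On the other hand, Hall's condition for the multiset 𝓘^a quantifies over all
-- sub-multisets b ≤ a; it is equivalent to the set Hall condition, because the
-- sub-multiset "all copies of I_i for i ∈ S" is the largest one whose support
-- lies in S, and the union of a sub-multiset depends only on its support.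

open import Defs
open import Data.Nat using (ℕ; zero; suc; _+_; _≤_; _<_; z≤n; s≤s)
open import Data.Nat.Properties using (≤-refl; ≤-trans; +-mono-≤; +-comm)
open import Data.Fin using (Fin)
import Data.Fin as Fin
open import Data.Fin.Subset using (Subset; ⋃; ∣_∣; ⊥; Nonempty; _⊆_)
open import Data.Fin.Subset.Properties using (⊥⊆; p⊆q⇒∣p∣≤∣q∣; x∈p∪q⁻; x∈p∪q⁺)
open import Data.Bool using (Bool; true; false; if_then_else_; _∨_)
open import Data.Vec using (_∷_; lookup)
open import Data.Vec.Properties using ([]=⇒lookup; lookup⇒[]=)
open import Data.List using (List; []; _∷_; map; allFin)
open import Data.List.Relation.Unary.Any using (here; there)
import Data.List.Membership.Propositional as List
open import Data.List.Membership.Propositional.Properties using (∈-allFin)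
open import Data.Nat.ListAction using (sum)
open import Data.Product using (_×_; _,_; ∃)
open import Data.Sum using (inj₁; inj₂)
open import Relation.Binary.PropositionalEquality using (_≡_; refl; sym; trans; subst)
open import Function.Bundles using (_⇔_; mk⇔; Equivalence)

sum-mono : ∀ {m} {f g : Fin m → ℕ} (xs : List (Fin m)) → (∀ i → f i ≤ g i) →
  sum (map f xs) ≤ sum (map g xs)
sum-mono []       f≤g = z≤n
sum-mono (x ∷ xs) f≤g = +-mono-≤ (f≤g x) (sum-mono xs f≤g)

Σᶠ-mono : ∀ {m} {f g : Fin m → ℕ} → (∀ i → f i ≤ g i) → Σᶠ f ≤ Σᶠ g
Σᶠ-mono {m} = sum-mono (allFin m)

sum-positive : ∀ {m} (b : Fin m → ℕ) (xs : List (Fin m)) →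
  0 < sum (map b xs) → ∃ λ i → 0 < b i
sum-positive b []       ()
sum-positive b (x ∷ xs) 0<sum with b x in bx≡
... | zero  = sum-positive b xs 0<sum
... | suc _ = x , subst (0 <_) (sym bx≡) (s≤s z≤n)

restrict : ∀ {m} → Subset m → (Fin m → ℕ) → Fin m → ℕ
restrict S a i = if lookup S i then a i else 0

restrict-≤ : ∀ {m} (S : Subset m) (a : Fin m → ℕ) i → restrict S a i ≤ a i
restrict-≤ S a i with lookup S i
... | true  = ≤-refl
... | false = z≤n

isPositive : ℕ → Bool
isPositive zero    = false
isPositive (suc _) = true

isPositive-< : ∀ {n} → 0 < n → isPositive n ≡ true
isPositive-< {suc _} _ = refl

lookup-support : ∀ {m} (b : Fin m → ℕ) i → lookup (support b) i ≡ isPositive (b i)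
lookup-support {suc m} b Fin.zero with b Fin.zero
... | zero  = refl
... | suc _ = refl
lookup-support {suc m} b (Fin.suc i) = lookup-support (λ j → b (Fin.suc j)) i

support-⊆ : ∀ {m} (S : Subset m) (a : Fin m → ℕ) → support (restrict S a) ⊆ S
support-⊆ S a {i} i∈supp
  with lookup S i in S∋i | trans (sym (lookup-support (restrict S a) i)) ([]=⇒lookup i∈supp)
... | true  | _  = lookup⇒[]= i S S∋i
... | false | ()

-- Outside its support a sequence vanishes, so b ≤ a implies b ≤ a restricted
-- to the support of b.
≤-restrict-support : ∀ {m} (a b : Fin m → ℕ) → (∀ i → b i ≤ a i) →
  ∀ i → b i ≤ restrict (support b) a i
≤-restrict-support a b b≤a i rewrite lookup-support b i with b i | b≤a i
... | zero  | _     = z≤n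
... | suc _ | b≤a-i = b≤a-i

support-nonempty : ∀ {m} (b : Fin m → ℕ) → 0 < Σᶠ b → Nonempty (support b)
support-nonempty {m} b 0<Σb with sum-positive b (allFin m) 0<Σb
... | i , 0<bi = i , lookup⇒[]= i (support b) (trans (lookup-support b i) (isPositive-< 0<bi))

⋃∈-mono : ∀ {m k} {T S : Subset m} (F : Fin m → Subset k) → T ⊆ S → ⋃∈ T F ⊆ ⋃∈ S F
⋃∈-mono {m} {T = T} {S} F T⊆S = go (allFin m)
  where
  go : ∀ xs → ⋃ (map (λ i → if lookup T i then F i else ⊥) xs)
            ⊆ ⋃ (map (λ i → if lookup S i then F i else ⊥) xs)
  go []       p = p
  go (x ∷ xs) p with x∈p∪q⁻ _ _ p
  ... | inj₂ q = x∈p∪q⁺ (inj₂ (go xs q))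
  ... | inj₁ q with lookup T x in Tx
  ...   | false = ⊥⊆ q
  ...   | true rewrite []=⇒lookup (T⊆S (lookup⇒[]= x T Tx)) = x∈p∪q⁺ (inj₁ q)

meets : ∀ {m} → Subset m → List (Fin m) → Bool
meets S []       = false
meets S (x ∷ xs) = lookup S x ∨ meets S xs

meets-∈ : ∀ {m} (S : Subset m) {xs : List (Fin m)} {x : Fin m} →
  x List.∈ xs → lookup S x ≡ true → meets S xs ≡ true
meets-∈ S {y ∷ xs} (here refl) Sx rewrite Sx = refl
meets-∈ S {y ∷ xs} (there x∈xs) Sx with lookup S y
... | true  = refl
... | false = meets-∈ S x∈xs Sx

⋃-Gbar : ∀ {m r} (S : Subset m) (I : Fin m → Subset r) (xs : List (Fin m)) →
  ⋃ (map (λ i → if lookup S i then Gbar-nbhd I i else ⊥) xs)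
    ≡ meets S xs ∷ ⋃ (map (λ i → if lookup S i then I i else ⊥) xs)
⋃-Gbar S I []       = refl
⋃-Gbar S I (x ∷ xs) rewrite ⋃-Gbar S I xs with lookup S x
... | true  = refl
... | false = refl

∣⋃∈-Gbar∣ : ∀ {m r} (S : Subset m) (I : Fin m → Subset r) → Nonempty S →
  ∣ ⋃∈ S (Gbar-nbhd I) ∣ ≡ suc ∣ ⋃∈ S I ∣
∣⋃∈-Gbar∣ {m} S I (x , x∈S)
  rewrite ⋃-Gbar S I (allFin m) | meets-∈ S (∈-allFin x) ([]=⇒lookup x∈S) = refl

SetHall : ∀ {r m} → (Fin m → Subset r) → (Fin m → ℕ) → Set
SetHall {m = m} I a = ∀ (S : Subset m) → Nonempty S → Σ∈ S a ≤ ∣ ⋃∈ S I ∣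

-- Hall's condition for the multiset 𝓘^a only needs to be checked on the
-- sub-multisets taking all copies of the sets they use.
valid⇔setHall : ∀ {r m} (I : Fin m → Subset r) (a : Fin m → ℕ) → Valid I a ⇔ SetHall I a
valid⇔setHall I a = mk⇔ toSetHall toValid
  where
  toSetHall : Valid I a → SetHall I a
  toSetHall valid S _ = ≤-trans (valid (restrict S a) (restrict-≤ S a))
                                (p⊆q⇒∣p∣≤∣q∣ (⋃∈-mono I (support-⊆ S a)))

  toValid : SetHall I a → Valid I a
  toValid hall b b≤a with Σᶠ b in Σb≡
  ... | zero  = z≤n
  ... | suc _ = subst (_≤ ∣ ⋃∈ (support b) I ∣) Σb≡
      (≤-trans (Σᶠ-mono (≤-restrict-support a b b≤a))
               (hall (support b) (support-nonempty b (subst (0 <_) (sym Σb≡) (s≤s z≤n)))))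

-- Because 0' is adjacent to everything, the dragon marriage inequality for
-- nonempty S is Hall's inequality shifted by one.
setHall⇔dragon : ∀ {r m} (I : Fin m → Subset r) (a : Fin m → ℕ) →
  SetHall I a ⇔ (∀ (S : Subset m) → Nonempty S → Σ∈ S a + 1 ≤ ∣ ⋃∈ S (Gbar-nbhd I) ∣)
setHall⇔dragon I a = mk⇔
  (λ hall S ne → shift S ne (s≤s (hall S ne)))
  (λ dragon S ne → unshift S ne (dragon S ne))
  where
  shift : ∀ S → Nonempty S → suc (Σ∈ S a) ≤ suc ∣ ⋃∈ S I ∣ →
          Σ∈ S a + 1 ≤ ∣ ⋃∈ S (Gbar-nbhd I) ∣
  shift S ne rewrite +-comm (Σ∈ S a) 1 | ∣⋃∈-Gbar∣ S I ne = λ p → p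

  unshift : ∀ S → Nonempty S → Σ∈ S a + 1 ≤ ∣ ⋃∈ S (Gbar-nbhd I) ∣ →
            Σ∈ S a ≤ ∣ ⋃∈ S I ∣
  unshift S ne rewrite +-comm (Σ∈ S a) 1 | ∣⋃∈-Gbar∣ S I ne = λ { (s≤s p) → p }

mainTheorem7 : (r n : ℕ) (A : Presentation r n) (m : ℕ) (I : Fin m → Subset r) →
    IsTypeEnumeration A I → (a : Fin m → ℕ) →
    (Valid I a × Maximal {r} a) ⇔ Draconian I a
mainTheorem7 r n A m I _ a = mk⇔
  (λ (valid , maximal) → maximal , to dragonCond (to hallCond valid))
  (λ (maximal , dragon) → from hallCond (from dragonCond dragon) , maximal)
  where
  open Equivalence
  hallCond : Valid I a ⇔ SetHall I a
  hallCond = valid⇔setHall I a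
  dragonCond : SetHall I a ⇔ (∀ S → Nonempty S → Σ∈ S a + 1 ≤ ∣ ⋃∈ S (Gbar-nbhd I) ∣)
  dragonCond = setHall⇔dragon I a
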